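{- The rule $Merge$ is admissible in $\mathrm{RTB}$: if $G\,/\!/\,\Gamma_1\Rightarrow\Delta_1\,/\!/\,\Gamma_2\Rightarrow\Delta_2\,/\!/\,G'$ is derivable in $\mathrm{RTB}$, then $G\,/\!/\,\Gamma_1,\Gamma_2\Rightarrow\Delta_1,\Delta_2\,/\!/\,G'$ is derivable in $\mathrm{RTB}$.
   Context: Hypersequents $S_1\,/\!/\,\dots\,/\!/\,S_n$ are finite lists of sequents $\Gamma\Rightarrow\Delta$ (pairs of finite sets of formulas). $\mathrm{RTB}$ is the cut-free calculus with: axiom $p\Rightarrow p$ ($p$ atomic); external weakening at the ends ($G$ to $\Rightarrow\,/\!/\,G$, $G$ to $G\,/\!/\,\Rightarrow$); internal weakening in any component; the usual sequent rules for $\neg,\land,\lor$ in any component; $\Box\mathrm{R}$: from $G\,/\!/\,\Gamma\Rightarrow\Delta\,/\!/\,\Rightarrow\phi$ infer $G\,/\!/\,\Gamma\Rightarrow\Box\phi,\Delta$; $\Box\mathrm{L}$: from $G\,/\!/\,\Gamma\Rightarrow\Delta\,/\!/\,\Sigma,\phi\Rightarrow\Lambda\,/\!/\,H$ infer $G\,/\!/\,\Gamma,\Box\phi\Rightarrow\Delta\,/\!/\,\Sigma\Rightarrow\Lambda\,/\!/\,H$; $Sym$: from $S_1\,/\!/\,\dots\,/\!/\,S_n$ infer $S_n\,/\!/\,\dots\,/\!/\,S_1$; and $T$: from $G\,/\!/\,\Gamma,\phi\Rightarrow\Delta\,/\!/\,G'$ infer $G\,/\!/\,\Gamma,\Box\phi\Rightarrow\Delta\,/\!/\,G'$.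 -}

module Defs where

open import Data.Nat using (ℕ)
open import Data.List using (List; []; _∷_; _++_; [_]; reverse)
open import Data.List.Membership.Propositional using (_∈_)
open import Data.List.Relation.Binary.Pointwise using (Pointwise)
open import Data.Product using (_×_)

data Fml : Set where
  atom : ℕ → Fml
  ¬'_  : Fml → Fml
  _∧'_ : Fml → Fml → Fml
  _∨'_ : Fml → Fml → Fml
  □_   : Fml → Fml

-- Finite sets of formulas are represented by lists, identified up to
-- having the same members (see the rule `setEq` below).
Ctx : Set
Ctx = List Fml

record Seq : Set where
  constructor _⇒_
  field
    ant : Ctx
    suc : Ctx

HSeq : Set
HSeq = List Seq

∅⇒∅ : Seq
∅⇒∅ = [] ⇒ []

_≋_ : Ctx → Ctx → Set
Γ ≋ Δ = ∀ φ → (φ ∈ Γ → φ ∈ Δ) × (φ ∈ Δ → φ ∈ Γ)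

_≋S_ : Seq → Seq → Set
(Γ ⇒ Δ) ≋S (Γ' ⇒ Δ') = (Γ ≋ Γ') × (Δ ≋ Δ')

_≋H_ : HSeq → HSeq → Set
G ≋H H = Pointwise _≋S_ G H

data RTB : HSeq → Set where
  setEq : ∀ {G H} → RTB G → G ≋H H → RTB H
  ax    : ∀ p → RTB [ [ atom p ] ⇒ [ atom p ] ]
  ewL   : ∀ {G} → RTB G → RTB (∅⇒∅ ∷ G)
  ewR   : ∀ {G} → RTB G → RTB (G ++ [ ∅⇒∅ ])
  iw    : ∀ {G H Γ Δ Σ Λ} → RTB (G ++ (Γ ⇒ Δ) ∷ H)
        → RTB (G ++ ((Σ ++ Γ) ⇒ (Λ ++ Δ)) ∷ H)
  ¬L    : ∀ {G H Γ Δ φ} → RTB (G ++ (Γ ⇒ (φ ∷ Δ)) ∷ H)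
        → RTB (G ++ ((¬' φ ∷ Γ) ⇒ Δ) ∷ H)
  ¬R    : ∀ {G H Γ Δ φ} → RTB (G ++ ((φ ∷ Γ) ⇒ Δ) ∷ H)
        → RTB (G ++ (Γ ⇒ (¬' φ ∷ Δ)) ∷ H)
  ∧L    : ∀ {G H Γ Δ φ ψ} → RTB (G ++ ((φ ∷ ψ ∷ Γ) ⇒ Δ) ∷ H)
        → RTB (G ++ (((φ ∧' ψ) ∷ Γ) ⇒ Δ) ∷ H)
  ∧R    : ∀ {G H Γ Δ φ ψ} → RTB (G ++ (Γ ⇒ (φ ∷ Δ)) ∷ H)
        → RTB (G ++ (Γ ⇒ (ψ ∷ Δ)) ∷ H)
        → RTB (G ++ (Γ ⇒ ((φ ∧' ψ) ∷ Δ)) ∷ H)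
  ∨L    : ∀ {G H Γ Δ φ ψ} → RTB (G ++ ((φ ∷ Γ) ⇒ Δ) ∷ H)
        → RTB (G ++ ((ψ ∷ Γ) ⇒ Δ) ∷ H)
        → RTB (G ++ (((φ ∨' ψ) ∷ Γ) ⇒ Δ) ∷ H)
  ∨R    : ∀ {G H Γ Δ φ ψ} → RTB (G ++ (Γ ⇒ (φ ∷ ψ ∷ Δ)) ∷ H)
        → RTB (G ++ (Γ ⇒ ((φ ∨' ψ) ∷ Δ)) ∷ H)
  □R    : ∀ {G Γ Δ φ} → RTB (G ++ (Γ ⇒ Δ) ∷ ([] ⇒ [ φ ]) ∷ [])
        → RTB (G ++ (Γ ⇒ (□ φ ∷ Δ)) ∷ [])
  □L    : ∀ {G H Γ Δ Σ Λ φ} → RTB (G ++ (Γ ⇒ Δ) ∷ ((φ ∷ Σ) ⇒ Λ) ∷ H)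
        → RTB (G ++ ((□ φ ∷ Γ) ⇒ Δ) ∷ (Σ ⇒ Λ) ∷ H)
  Sym   : ∀ {G} → RTB G → RTB (reverse G)
  T     : ∀ {G H Γ Δ φ} → RTB (G ++ ((φ ∷ Γ) ⇒ Δ) ∷ H)
        → RTB (G ++ ((□ φ ∷ Γ) ⇒ Δ) ∷ H)

{-# OPTIONS --safe #-}
-- The propositional rules, T and internal weakening change an active part of one
-- component and leave its side context arbitrary, so merging a neighbour into that component only
-- enlarges the side context; rules acting away from the merged pair commute with the merge;
-- Sym reverses the pair, which is harmless because components are sets.  The only genuinely
-- modal case is □L applied across the pair: merging its two components produces an instance of T.
module Submission where

open import Defs
open import Data.List using ([]; _∷_; _++_; [_]; reverse)
open import Data.List.Properties
  using (++-assoc; ++-identityʳ; ∷-injectiveˡ; ∷-injectiveʳ; reverse-++; reverse-involutive; unfold-reverse)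
open import Data.List.Relation.Binary.Pointwise using ([]; _∷_; ++⁺)
open import Data.List.Relation.Binary.Permutation.Propositional using (_↭_; ↭-sym; ↭-reflexive)
open import Data.List.Relation.Binary.Permutation.Propositional.Properties using (∈-resp-↭; shifts; ++-comm)
open import Data.List.Relation.Binary.Subset.Propositional.Properties using () renaming (++⁺ to ⊆-++⁺)
open import Data.Empty using (⊥-elim)
open import Data.Product using (_×_; _,_; proj₁; proj₂)
open import Relation.Binary.PropositionalEquality
  using (_≡_; _≢_; refl; sym; trans; cong; cong₂; subst; module ≡-Reasoning)

open Seq

infixl 6 _⊕_
infix 4 _↭S_

_⊕_ : Seq → Seq → Seq
A ⊕ B = (ant A ++ ant B) ⇒ (suc A ++ suc B)

_↭S_ : Seq → Seq → Set
S ↭S S' = (ant S ↭ ant S') × (suc S ↭ suc S')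

↭S-sym : ∀ {S S'} → S ↭S S' → S' ↭S S
↭S-sym (p , q) = ↭-sym p , ↭-sym q

⊕-comm : ∀ A B → A ⊕ B ↭S B ⊕ A
⊕-comm A B = ++-comm (ant A) (ant B) , ++-comm (suc A) (suc B)

⊕-assoc : ∀ A B C → A ⊕ B ⊕ C ↭S A ⊕ (B ⊕ C)
⊕-assoc A B C =
  ↭-reflexive (++-assoc (ant A) (ant B) (ant C)) , ↭-reflexive (++-assoc (suc A) (suc B) (suc C))

⊕-shift : ∀ A B C → A ⊕ (B ⊕ C) ↭S B ⊕ (A ⊕ C)
⊕-shift A B C = shifts (ant A) (ant B) , shifts (suc A) (suc B)

⊕-identityʳ : ∀ A → A ⊕ ∅⇒∅ ↭S A
⊕-identityʳ A = ↭-reflexive (++-identityʳ (ant A)) , ↭-reflexive (++-identityʳ (suc A))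

↭⇒≋ : ∀ {Γ Δ} → Γ ↭ Δ → Γ ≋ Δ
↭⇒≋ p φ = ∈-resp-↭ p , ∈-resp-↭ (↭-sym p)

≋-refl : ∀ {Γ} → Γ ≋ Γ
≋-refl φ = (λ m → m) , (λ m → m)

≋-++ : ∀ {Γ Γ' Δ Δ'} → Γ ≋ Γ' → Δ ≋ Δ' → (Γ ++ Δ) ≋ (Γ' ++ Δ')
≋-++ p q φ = ⊆-++⁺ (proj₁ (p _)) (proj₁ (q _)) , ⊆-++⁺ (proj₂ (p _)) (proj₂ (q _))

≋S-⊕ : ∀ {A A' B B'} → A ≋S A' → B ≋S B' → (A ⊕ B) ≋S (A' ⊕ B')
≋S-⊕ (pΓ , pΔ) (qΓ , qΔ) = ≋-++ pΓ qΓ , ≋-++ pΔ qΔ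

≋H-refl : ∀ G → G ≋H G
≋H-refl []      = []
≋H-refl (S ∷ G) = (≋-refl , ≋-refl) ∷ ≋H-refl G

reorder : ∀ {G H S S'} → S ↭S S' → RTB (G ++ S ∷ H) → RTB (G ++ S' ∷ H)
reorder {G} {H} (p , q) d = setEq d (++⁺ (≋H-refl G) ((↭⇒≋ p , ↭⇒≋ q) ∷ ≋H-refl H))

++-∷-assoc : ∀ (G : HSeq) S M H → (G ++ S ∷ M) ++ H ≡ G ++ S ∷ M ++ H
++-∷-assoc G S M H = ++-assoc G (S ∷ M) H

[]≢++-∷ : ∀ (G : HSeq) {S H} → [] ≢ G ++ S ∷ H
[]≢++-∷ []      ()
[]≢++-∷ (_ ∷ _) ()

reverse-++-∷ : ∀ (G : HSeq) S H → reverse (G ++ S ∷ H) ≡ reverse H ++ S ∷ reverse G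
reverse-++-∷ G S H = begin
  reverse (G ++ S ∷ H)               ≡⟨ reverse-++ G (S ∷ H) ⟩
  reverse (S ∷ H) ++ reverse G       ≡⟨ cong (_++ reverse G) (unfold-reverse S H) ⟩
  (reverse H ++ [ S ]) ++ reverse G  ≡⟨ ++-assoc (reverse H) [ S ] (reverse G) ⟩
  reverse H ++ S ∷ reverse G         ∎
  where open ≡-Reasoning

data Position (G₀ : HSeq) (S : Seq) (H₀ G : HSeq) (A B : Seq) (G' : HSeq) : Set where
  before : ∀ M → G ≡ G₀ ++ S ∷ M → H₀ ≡ M ++ A ∷ B ∷ G' → Position G₀ S H₀ G A B G'
  first  : G₀ ≡ G → S ≡ A → H₀ ≡ B ∷ G' → Position G₀ S H₀ G A B G'
  second : G₀ ≡ G ++ [ A ] → S ≡ B → H₀ ≡ G' → Position G₀ S H₀ G A B G'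
  after  : ∀ N → G₀ ≡ G ++ A ∷ B ∷ N → G' ≡ N ++ S ∷ H₀ → Position G₀ S H₀ G A B G'

position : ∀ G₀ S H₀ G A B G' → G₀ ++ S ∷ H₀ ≡ G ++ A ∷ B ∷ G' → Position G₀ S H₀ G A B G'
position []            S H₀ []      A B G' refl = first refl refl refl
position []            S H₀ (_ ∷ G) A B G' refl = before G refl refl
position (_ ∷ [])      S H₀ []      A B G' refl = second refl refl refl
position (_ ∷ _ ∷ G₀) S H₀ []      A B G' refl = after G₀ refl refl
position (S₀ ∷ G₀)      S H₀ (_ ∷ G) A B G' eq with ∷-injectiveˡ eq | position G₀ S H₀ G A B G' (∷-injectiveʳ eq)
... | refl | before M e₁ e₂ = before M (cong (S₀ ∷_) e₁) e₂
... | refl | first e₁ e₂ e₃ = first (cong (S₀ ∷_) e₁) e₂ e₃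
... | refl | second e₁ e₂ e₃ = second (cong (S₀ ∷_) e₁) e₂ e₃
... | refl | after N e₁ e₂ = after N (cong (S₀ ∷_) e₁) e₂

Mergeable : HSeq → Set
Mergeable L = ∀ G G' A B → L ≡ G ++ A ∷ B ∷ G' → RTB (G ++ A ⊕ B ∷ G')

merge-after : ∀ G₀ S M {A B G'}
  → Mergeable (G₀ ++ S ∷ M ++ A ∷ B ∷ G') → RTB (G₀ ++ S ∷ M ++ A ⊕ B ∷ G')
merge-after G₀ S M {A} {B} {G'} ih =
  subst RTB (++-∷-assoc G₀ S M _) (ih (G₀ ++ S ∷ M) G' A B (sym (++-∷-assoc G₀ S M _)))

merge-before : ∀ G {A B} N S H
  → Mergeable ((G ++ A ∷ B ∷ N) ++ S ∷ H) → RTB ((G ++ A ⊕ B ∷ N) ++ S ∷ H)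
merge-before G {A} {B} N S H ih =
  subst RTB (sym (++-∷-assoc G (A ⊕ B) N _)) (ih G (N ++ S ∷ H) A B (++-∷-assoc G A (B ∷ N) _))

-- A rule on one component with active parts S₁, S₂ ⟹ S in an arbitrary side context C.
Rule₂ : Seq → Seq → Seq → Set
Rule₂ S₁ S₂ S = ∀ {G H C} → RTB (G ++ S₁ ⊕ C ∷ H) → RTB (G ++ S₂ ⊕ C ∷ H) → RTB (G ++ S ⊕ C ∷ H)

Rule₁ : Seq → Seq → Set
Rule₁ S₁ S = ∀ {G H C} → RTB (G ++ S₁ ⊕ C ∷ H) → RTB (G ++ S ⊕ C ∷ H)

rule-⊕ʳ : ∀ {S₁ S₂ S} → Rule₂ S₁ S₂ S → ∀ {G H C X}
  → RTB (G ++ S₁ ⊕ C ⊕ X ∷ H) → RTB (G ++ S₂ ⊕ C ⊕ X ∷ H) → RTB (G ++ S ⊕ C ⊕ X ∷ H)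
rule-⊕ʳ {S₁} {S₂} {S} r {C = C} {X} d e =
  reorder (↭S-sym (⊕-assoc S C X)) (r (reorder (⊕-assoc S₁ C X) d) (reorder (⊕-assoc S₂ C X) e))

rule-⊕ˡ : ∀ {S₁ S₂ S} → Rule₂ S₁ S₂ S → ∀ {G H C X}
  → RTB (G ++ X ⊕ (S₁ ⊕ C) ∷ H) → RTB (G ++ X ⊕ (S₂ ⊕ C) ∷ H) → RTB (G ++ X ⊕ (S ⊕ C) ∷ H)
rule-⊕ˡ {S₁} {S₂} {S} r {C = C} {X} d e =
  reorder (⊕-shift S X C) (r (reorder (⊕-shift X S₁ C) d) (reorder (⊕-shift X S₂ C) e))

mergeable-rule₂ : ∀ G₀ H₀ {S₁ S₂ S C} → Rule₂ S₁ S₂ S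
  → Mergeable (G₀ ++ S₁ ⊕ C ∷ H₀) → Mergeable (G₀ ++ S₂ ⊕ C ∷ H₀) → Mergeable (G₀ ++ S ⊕ C ∷ H₀)
mergeable-rule₂ G₀ H₀ {S₁} {S₂} {S} {C} r ih₁ ih₂ G G' A B eq with position G₀ (S ⊕ C) H₀ G A B G' eq
... | before M refl refl =
  subst RTB (sym (++-∷-assoc G₀ (S ⊕ C) M _)) (r (merge-after G₀ _ M ih₁) (merge-after G₀ _ M ih₂))
... | first refl refl refl = rule-⊕ʳ r (ih₁ G G' _ B refl) (ih₂ G G' _ B refl)
... | second refl refl refl =
  rule-⊕ˡ r {C = C} {A} (ih₁ G G' A _ (++-∷-assoc G A [] _)) (ih₂ G G' A _ (++-∷-assoc G A [] _))
... | after N refl refl =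
  subst RTB (++-∷-assoc G (A ⊕ B) N _) (r (merge-before G N _ H₀ ih₁) (merge-before G N _ H₀ ih₂))

mergeable-rule₁ : ∀ G₀ H₀ {S₁ S C} → Rule₁ S₁ S
  → Mergeable (G₀ ++ S₁ ⊕ C ∷ H₀) → Mergeable (G₀ ++ S ⊕ C ∷ H₀)
mergeable-rule₁ G₀ H₀ r ih = mergeable-rule₂ G₀ H₀ (λ d _ → r d) ih ih

record ≋H-Split (G xs ys : HSeq) : Set where
  constructor split
  field
    {xs₁ xs₂} : HSeq
    xs≡ : xs ≡ xs₁ ++ xs₂
    xs₁≋ : xs₁ ≋H G
    xs₂≋ : xs₂ ≋H ys

≋H-split : ∀ G {xs ys} → xs ≋H (G ++ ys) → ≋H-Split G xs ys
≋H-split []      p = split refl [] p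
≋H-split (_ ∷ G) (r ∷ p) with ≋H-split G p
... | split refl q₁ q₂ = split refl (r ∷ q₁) q₂

merge-admissible : ∀ {L} → RTB L → Mergeable L
merge-admissible (setEq d p) G G' A B refl with ≋H-split G p
... | split {G₀} {A₀ ∷ B₀ ∷ G₀'} refl pG (pA ∷ pB ∷ pG') =
  setEq (merge-admissible d G₀ G₀' A₀ B₀ refl) (++⁺ pG (≋S-⊕ pA pB ∷ pG'))
merge-admissible (ax p) []      G' A B ()
merge-admissible (ax p) (_ ∷ G) G' A B eq = ⊥-elim ([]≢++-∷ G (∷-injectiveʳ eq))
merge-admissible (ewL d) []      G' A B refl = d
merge-admissible (ewL d) (_ ∷ G) G' A B eq with ∷-injectiveˡ eq
... | refl = ewL (merge-admissible d G G' A B (∷-injectiveʳ eq))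
merge-admissible (ewR {G₀} d) G G' A B eq with position G₀ ∅⇒∅ [] G A B G' eq
... | before M _ e         = ⊥-elim ([]≢++-∷ M e)
... | first _ _ ()
... | second refl refl refl = reorder (↭S-sym (⊕-identityʳ A)) d
... | after N refl refl    = subst RTB (++-∷-assoc G (A ⊕ B) N _) (ewR (merge-admissible d G N A B refl))
merge-admissible (iw {G₀} {H₀} {Γ} {Δ} {Σ} {Λ} d) =
  mergeable-rule₁ G₀ H₀ {∅⇒∅} {Σ ⇒ Λ} {Γ ⇒ Δ} iw (merge-admissible d)
merge-admissible (¬L {G₀} {H₀} {Γ} {Δ} {φ} d) =
  mergeable-rule₁ G₀ H₀ {[] ⇒ [ φ ]} {[ ¬' φ ] ⇒ []} {Γ ⇒ Δ} ¬L (merge-admissible d)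
merge-admissible (¬R {G₀} {H₀} {Γ} {Δ} {φ} d) =
  mergeable-rule₁ G₀ H₀ {[ φ ] ⇒ []} {[] ⇒ [ ¬' φ ]} {Γ ⇒ Δ} ¬R (merge-admissible d)
merge-admissible (∧L {G₀} {H₀} {Γ} {Δ} {φ} {ψ} d) =
  mergeable-rule₁ G₀ H₀ {(φ ∷ ψ ∷ []) ⇒ []} {[ φ ∧' ψ ] ⇒ []} {Γ ⇒ Δ} ∧L (merge-admissible d)
merge-admissible (∨R {G₀} {H₀} {Γ} {Δ} {φ} {ψ} d) =
  mergeable-rule₁ G₀ H₀ {[] ⇒ (φ ∷ ψ ∷ [])} {[] ⇒ [ φ ∨' ψ ]} {Γ ⇒ Δ} ∨R (merge-admissible d)
merge-admissible (T {G₀} {H₀} {Γ} {Δ} {φ} d) =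
  mergeable-rule₁ G₀ H₀ {[ φ ] ⇒ []} {[ □ φ ] ⇒ []} {Γ ⇒ Δ} T (merge-admissible d)
merge-admissible (∧R {G₀} {H₀} {Γ} {Δ} {φ} {ψ} d e) =
  mergeable-rule₂ G₀ H₀ {[] ⇒ [ φ ]} {[] ⇒ [ ψ ]} {[] ⇒ [ φ ∧' ψ ]} {Γ ⇒ Δ} ∧R
    (merge-admissible d) (merge-admissible e)
merge-admissible (∨L {G₀} {H₀} {Γ} {Δ} {φ} {ψ} d e) =
  mergeable-rule₂ G₀ H₀ {[ φ ] ⇒ []} {[ ψ ] ⇒ []} {[ φ ∨' ψ ] ⇒ []} {Γ ⇒ Δ} ∨L
    (merge-admissible d) (merge-admissible e)
merge-admissible (□R {G₀} {Γ} {Δ} {φ} d) G G' A B eq with position G₀ (Γ ⇒ (□ φ ∷ Δ)) [] G A B G' eq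
... | before M _ e          = ⊥-elim ([]≢++-∷ M e)
... | first _ _ ()
... | second refl refl refl =
  reorder (⊕-shift ([] ⇒ [ □ φ ]) A (Γ ⇒ Δ))
    (□R (merge-admissible d G _ A (Γ ⇒ Δ) (++-∷-assoc G A [] _)))
... | after N refl refl     =
  subst RTB (++-∷-assoc G (A ⊕ B) N _) (□R (merge-before G N _ _ (merge-admissible d)))
merge-admissible (□L {G₀} {H₀} {Γ} {Δ} {Σ} {Λ} {φ} d) G G' A B eq
  with position G₀ ((□ φ ∷ Γ) ⇒ Δ) ((Σ ⇒ Λ) ∷ H₀) G A B G' eq
... | before [] refl refl =
  subst RTB (sym (++-∷-assoc G₀ _ [] _)) (□L (merge-after G₀ (Γ ⇒ Δ) [] (merge-admissible d)))
... | before (_ ∷ M) refl refl =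
  subst RTB (sym (++-∷-assoc G₀ _ (_ ∷ M) _)) (□L (merge-after G₀ (Γ ⇒ Δ) (_ ∷ M) (merge-admissible d)))
-- Merging the two components of □L turns it into T.
... | first refl refl refl =
  T (reorder (⊕-shift (Γ ⇒ Δ) ([ φ ] ⇒ []) (Σ ⇒ Λ)) (merge-admissible d G G' (Γ ⇒ Δ) _ refl))
... | second refl refl refl =
  reorder (⊕-shift ([ □ φ ] ⇒ []) A (Γ ⇒ Δ))
    (□L (merge-admissible d G _ A (Γ ⇒ Δ) (++-∷-assoc G A [] _)))
... | after N refl refl =
  subst RTB (++-∷-assoc G (A ⊕ B) N _) (□L (merge-before G N _ _ (merge-admissible d)))
merge-admissible (Sym {L} d) G G' A B eq =
  reorder (⊕-comm B A) (subst RTB reversed (Sym (merge-admissible d (reverse G') (reverse G) B A L≡)))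
  where
  open ≡-Reasoning
  L≡ : L ≡ reverse G' ++ B ∷ A ∷ reverse G
  L≡ = begin
    L                                        ≡⟨ reverse-involutive L ⟨
    reverse (reverse L)                      ≡⟨ cong reverse eq ⟩
    reverse (G ++ A ∷ B ∷ G')                ≡⟨ reverse-++-∷ G A (B ∷ G') ⟩
    reverse (B ∷ G') ++ A ∷ reverse G        ≡⟨ cong (_++ A ∷ reverse G) (unfold-reverse B G') ⟩
    (reverse G' ++ [ B ]) ++ A ∷ reverse G   ≡⟨ ++-assoc (reverse G') [ B ] (A ∷ reverse G) ⟩
    reverse G' ++ B ∷ A ∷ reverse G          ∎
  reversed : reverse (reverse G' ++ B ⊕ A ∷ reverse G) ≡ G ++ B ⊕ A ∷ G'
  reversed = trans (reverse-++-∷ (reverse G') (B ⊕ A) (reverse G))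
                   (cong₂ (λ U V → U ++ B ⊕ A ∷ V) (reverse-involutive G) (reverse-involutive G'))

mainTheorem17 : ∀ (G G' : HSeq) (Γ₁ Δ₁ Γ₂ Δ₂ : Ctx)
    → RTB (G ++ (Γ₁ ⇒ Δ₁) ∷ (Γ₂ ⇒ Δ₂) ∷ G')
    → RTB (G ++ ((Γ₁ ++ Γ₂) ⇒ (Δ₁ ++ Δ₂)) ∷ G')
mainTheorem17 G G' Γ₁ Δ₁ Γ₂ Δ₂ d = merge-admissible d G G' (Γ₁ ⇒ Δ₁) (Γ₂ ⇒ Δ₂) refl
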